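{- Let $G=(V,E)$ be a graph and $X$ a cluster vertex deletion of $G$. For $x\in X$, let $L_x$ be the set of clusters of $G[V\setminus X]$ containing a neighbor of $x$, and for a cluster $C\in L_x$ let $P^+_{x,C}=C\cap N(x)$ and $P^-_{x,C}=C\setminus N(x)$. Let $X_0=\{x\in X: |L_x|>|X|+1\}$, and let $V'$ be any set consisting of every $x\in X\setminus X_0$ together with, for every such $x$ and every $C\in L_x$, a subset of $P^+_{x,C}$ of size $\min(|P^+_{x,C}|,|X|+1)$ and a subset of $P^-_{x,C}$ of size $\min(|P^-_{x,C}|,|X|+1)$. Then for every cluster vertex deletion $T$ of $G$ with $|T|\le|X|$: (1) $X_0\subseteq T$, and (2) $T\cap V'$ is a cluster vertex deletion of $G[V']$.
   Context: A cluster graph is a graph each of whose connected components (clusters) is a clique. A set $X\subseteq V$ is a cluster vertex deletion of $G$ if $G[V\setminus X]$ is a cluster graph. -}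

module Defs where

open import Data.Nat using (ℕ; suc; _+_)
open import Data.Bool using (Bool; true; false)
open import Data.Fin using (Fin)
open import Data.Fin.Subset using (Subset; _∈_; _∉_; _∩_; ∁; ∣_∣)
open import Data.Vec using (tabulate)
open import Data.Product using (Σ; ∃; _×_)
open import Data.Sum using (_⊎_)
open import Data.Empty using (⊥)
open import Function.Definitions using (Injective)
open import Relation.Binary.PropositionalEquality using (_≡_)

record Graph (n : ℕ) : Set where
  field
    adj   : Fin n → Fin n → Bool
    sym   : ∀ u v → adj u v ≡ adj v u
    loopless : ∀ v → adj v v ≡ false

module _ {n : ℕ} (G : Graph n) where
  open Graph G

  Adj : Fin n → Fin n → Set
  Adj u v = adj u v ≡ true

  N : Fin n → Subset n
  N x = tabulate (adj x)

  data Path (S : Fin n → Set) : Fin n → Fin n → Set where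
    here : ∀ {u} → S u → Path S u u
    step : ∀ {u w v} → S u → Adj u w → Path S w v → Path S u v

  -- G[S] is a cluster graph: every connected component is a clique,
  -- i.e. any two distinct vertices in the same component are adjacent.
  IsClusterGraph : (Fin n → Set) → Set
  IsClusterGraph S = ∀ u v → Path S u v → u ≡ v ⊎ Adj u v

  IsCVD : Subset n → Set
  IsCVD X = IsClusterGraph (λ v → v ∉ X)

  IsClusterOf : (Fin n → Set) → Subset n → Set
  IsClusterOf S C =
    (∀ v → v ∈ C → S v) ×
    (∃ λ v → v ∈ C) ×
    (∀ u v → u ∈ C → v ∈ C → Path S u v) ×
    (∀ u v → u ∈ C → S v → Adj u v → v ∈ C)

  L : Subset n → Fin n → Subset n → Set
  L X x C = IsClusterOf (λ v → v ∉ X) C × (∃ λ v → v ∈ C × Adj x v)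

  P⁺ : Fin n → Subset n → Subset n
  P⁺ x C = C ∩ N x

  P⁻ : Fin n → Subset n → Subset n
  P⁻ x C = C ∩ ∁ (N x)

  MoreThan : ℕ → (Subset n → Set) → Set
  MoreThan m P = Σ (Fin (suc m) → Subset n) λ f → Injective _≡_ _≡_ f × (∀ i → P (f i))

  X₀ : Subset n → Fin n → Set
  X₀ X x = x ∈ X × MoreThan (∣ X ∣ + 1) (L X x)

  V' : Subset n → (Q⁺ Q⁻ : Fin n → Subset n → Subset n) → Fin n → Set
  V' X Q⁺ Q⁻ v =
    (v ∈ X × (X₀ X v → ⊥)) ⊎
    (∃ λ x → ∃ λ C → (x ∈ X × (X₀ X x → ⊥)) × L X x C × (v ∈ Q⁺ x C ⊎ v ∈ Q⁻ x C))

-- Part (1): if x ∈ X₀ were outside T, pick in each of |X| + 2 clusters of L_x a neighbour of x.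
-- These neighbours are distinct, and T, having at most |X| vertices, misses two of them,
-- which are then joined through x by a path in G − T.  As G − T is a cluster graph they are
-- equal or adjacent, so their clusters of G − X coincide: a contradiction.
-- Part (2) holds because being a cluster graph is inherited by induced subgraphs, and
-- G[V'] − T is an induced subgraph of G − T.
module Submission where

open import Defs
open import Data.Nat using (ℕ; suc; _+_; _≤_; _<_; _⊓_; z≤n; s≤s)
open import Data.Nat.Properties using (≤-trans; n≤1+n; <⇒≱; +-comm)
open import Data.Fin using (Fin; zero; suc; punchIn)
open import Data.Fin.Properties using (any?; 0≢1+n; suc-injective; punchIn-injective; punchInᵢ≢i)
open import Data.Fin.Subset using (Subset; _∈_; _∉_; _⊆_; _-_; ∣_∣)
open import Data.Fin.Subset.Properties using (_∈?_; ⊆-antisym; x∈p∧x≢y⇒x∈p-y; x∈p⇒∣p-x∣<∣p∣)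
open import Data.Product using (_×_; _,_; proj₁; proj₂; ∃; ∃₂)
open import Data.Sum using (inj₁; inj₂)
open import Data.Empty using (⊥)
open import Function using (_∘_)
open import Function.Definitions using (Injective)
open import Relation.Nullary using (¬_; yes; no; contradiction)
open import Relation.Nullary.Decidable using (¬?; decidable-stable)
open import Relation.Binary.PropositionalEquality using (_≡_; _≢_; refl; sym; trans; subst)

module _ {n : ℕ} where

  injective⇒≤∣_∣ : ∀ {k} (p : Subset n) {f : Fin k → Fin n} →
    Injective _≡_ _≡_ f → (∀ i → f i ∈ p) → k ≤ ∣ p ∣
  injective⇒≤∣_∣ {k = 0}     p inj f∈p = z≤n
  injective⇒≤∣_∣ {k = suc k} p {f} inj f∈p =
    ≤-trans (s≤s (injective⇒≤∣ p - f zero ∣ (suc-injective ∘ inj) f∘suc∈p-f₀))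
            (x∈p⇒∣p-x∣<∣p∣ (f∈p zero))
    where
    f∘suc∈p-f₀ : ∀ i → f (suc i) ∈ p - f zero
    f∘suc∈p-f₀ i = x∈p∧x≢y⇒x∈p-y (f∈p (suc i)) (0≢1+n ∘ sym ∘ inj)

  injective-escapes : ∀ {k} (p : Subset n) {f : Fin k → Fin n} →
    Injective _≡_ _≡_ f → ∣ p ∣ < k → ∃ λ i → f i ∉ p
  injective-escapes p {f} inj ∣p∣<k with any? (λ i → ¬? (f i ∈? p))
  ... | yes escape = escape
  ... | no ¬escape = contradiction (injective⇒≤∣ p ∣ inj f∈p) (<⇒≱ ∣p∣<k)
    where
    f∈p : ∀ i → f i ∈ p
    f∈p i = decidable-stable (f i ∈? p) (λ fi∉p → ¬escape (i , fi∉p))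

  injective-escapes-twice : ∀ {k} (p : Subset n) {f : Fin (suc k) → Fin n} →
    Injective _≡_ _≡_ f → ∣ p ∣ < k → ∃₂ λ i j → i ≢ j × f i ∉ p × f j ∉ p
  injective-escapes-twice p {f} inj ∣p∣<k =
    let i , fi∉p = injective-escapes p inj (≤-trans ∣p∣<k (n≤1+n _))
        j , fj∉p = injective-escapes p (punchIn-injective i _ _ ∘ inj) ∣p∣<k
    in  i , punchIn i j , punchInᵢ≢i i j ∘ sym , fi∉p , fj∉p

module _ {n : ℕ} (G : Graph n) where

  adj-sym : ∀ {u v} → Adj G u v → Adj G v u
  adj-sym {u} {v} uv = trans (sym (Graph.sym G u v)) uv

  path-source : ∀ {S u v} → Path G S u v → S u
  path-source (here s)     = s
  path-source (step s _ _) = s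

  path-mono : ∀ {S S' : Fin n → Set} → (∀ v → S v → S' v) →
    ∀ {u v} → Path G S u v → Path G S' u v
  path-mono S⊆S' (here s)        = here (S⊆S' _ s)
  path-mono S⊆S' (step s uw wv) = step (S⊆S' _ s) uw (path-mono S⊆S' wv)

  isClusterGraph-mono : ∀ {S S' : Fin n → Set} → (∀ v → S' v → S v) →
    IsClusterGraph G S → IsClusterGraph G S'
  isClusterGraph-mono S'⊆S cluster u v = cluster u v ∘ path-mono S'⊆S

  module _ {S : Fin n → Set} where

    cluster-closed : ∀ {C} → IsClusterOf G S C → ∀ {u v} → Path G S u v → u ∈ C → v ∈ C
    cluster-closed C-cluster (here _)        u∈C = u∈C
    cluster-closed C-cluster (step _ uw wv) u∈C =
      cluster-closed C-cluster wv (proj₂ (proj₂ (proj₂ C-cluster)) _ _ u∈C (path-source wv) uw)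

    clusters-meet⇒≡ : ∀ {C D} → IsClusterOf G S C → IsClusterOf G S D →
      ∀ {v} → v ∈ C → v ∈ D → C ≡ D
    clusters-meet⇒≡ C-cluster@(_ , _ , C-connected , _) D-cluster@(_ , _ , D-connected , _) {v} v∈C v∈D =
      ⊆-antisym (λ u∈C → cluster-closed D-cluster (C-connected v _ v∈C u∈C) v∈D)
                (λ u∈D → cluster-closed C-cluster (D-connected v _ v∈D u∈D) v∈C)

    clusters-adjacent⇒≡ : ∀ {C D} → IsClusterOf G S C → IsClusterOf G S D →
      ∀ {u v} → u ∈ C → v ∈ D → Adj G u v → C ≡ D
    clusters-adjacent⇒≡ C-cluster D-cluster u∈C v∈D uv =
      clusters-meet⇒≡ C-cluster D-cluster
        (proj₂ (proj₂ (proj₂ C-cluster)) _ _ u∈C (proj₁ D-cluster _ v∈D) uv) v∈D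

  module _ (X : Subset n) (x : Fin n) where

    neighbourIn : ∀ {C} → L G X x C → Fin n
    neighbourIn (_ , v , _) = v

    neighbourIn-∈ : ∀ {C} (C∈Lx : L G X x C) → neighbourIn C∈Lx ∈ C
    neighbourIn-∈ (_ , _ , v∈C , _) = v∈C

    neighbourIn-adj : ∀ {C} (C∈Lx : L G X x C) → Adj G x (neighbourIn C∈Lx)
    neighbourIn-adj (_ , _ , _ , xv) = xv

    neighbourIn-injective : ∀ {k} {Cs : Fin k → Subset n} → Injective _≡_ _≡_ Cs →
      (Cs∈Lx : ∀ i → L G X x (Cs i)) → Injective _≡_ _≡_ (neighbourIn ∘ Cs∈Lx)
    neighbourIn-injective inj Cs∈Lx {i} {j} vᵢ≡vⱼ =
      inj (clusters-meet⇒≡ (proj₁ (Cs∈Lx i)) (proj₁ (Cs∈Lx j)) (neighbourIn-∈ (Cs∈Lx i))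
            (subst (_∈ _) (sym vᵢ≡vⱼ) (neighbourIn-∈ (Cs∈Lx j))))

    X₀⊆cvd : ∀ T → IsCVD G T → ∣ T ∣ ≤ ∣ X ∣ → X₀ G X x → x ∈ T
    X₀⊆cvd T T-cvd ∣T∣≤∣X∣ (_ , Cs , inj , Cs∈Lx) =
      decidable-stable (x ∈? T) x∉T-absurd
      where
      v : Fin (suc (∣ X ∣ + 1)) → Fin n
      v = neighbourIn ∘ Cs∈Lx

      ∣T∣<∣X∣+1 : ∣ T ∣ < ∣ X ∣ + 1
      ∣T∣<∣X∣+1 = subst (∣ T ∣ <_) (+-comm 1 ∣ X ∣) (s≤s ∣T∣≤∣X∣)

      x∉T-absurd : x ∉ T → ⊥
      x∉T-absurd x∉T
        with i , j , i≢j , vᵢ∉T , vⱼ∉T ← injective-escapes-twice T (neighbourIn-injective inj Cs∈Lx) ∣T∣<∣X∣+1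
        = i≢j (inj Cᵢ≡Cⱼ)
        where
        vᵢ∈Cᵢ = neighbourIn-∈ (Cs∈Lx i)
        vⱼ∈Cⱼ = neighbourIn-∈ (Cs∈Lx j)
        Cᵢ≡Cⱼ : Cs i ≡ Cs j
        Cᵢ≡Cⱼ with T-cvd (v i) (v j)
                     (step vᵢ∉T (adj-sym (neighbourIn-adj (Cs∈Lx i)))
                       (step x∉T (neighbourIn-adj (Cs∈Lx j)) (here vⱼ∉T)))
        ... | inj₁ vᵢ≡vⱼ = clusters-meet⇒≡ (proj₁ (Cs∈Lx i)) (proj₁ (Cs∈Lx j)) vᵢ∈Cᵢ
                              (subst (_∈ Cs j) (sym vᵢ≡vⱼ) vⱼ∈Cⱼ)
        ... | inj₂ vᵢvⱼ = clusters-adjacent⇒≡ (proj₁ (Cs∈Lx i)) (proj₁ (Cs∈Lx j)) vᵢ∈Cᵢ vⱼ∈Cⱼ vᵢvⱼ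

lemma6 : ∀ {n} (G : Graph n) (X : Subset n) → IsCVD G X →
    (Q⁺ Q⁻ : Fin n → Subset n → Subset n) →
    (∀ x C → x ∈ X → ¬ X₀ G X x → L G X x C →
      (Q⁺ x C ⊆ P⁺ G x C × ∣ Q⁺ x C ∣ ≡ ∣ P⁺ G x C ∣ ⊓ (∣ X ∣ + 1)) ×
      (Q⁻ x C ⊆ P⁻ G x C × ∣ Q⁻ x C ∣ ≡ ∣ P⁻ G x C ∣ ⊓ (∣ X ∣ + 1))) →
    ∀ (T : Subset n) → IsCVD G T → ∣ T ∣ ≤ ∣ X ∣ →
      (∀ x → X₀ G X x → x ∈ T) ×
      IsClusterGraph G (λ v → V' G X Q⁺ Q⁻ v × v ∉ T)
lemma6 G X _ Q⁺ Q⁻ _ T T-cvd ∣T∣≤∣X∣ =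
  (λ x → X₀⊆cvd G X x T T-cvd ∣T∣≤∣X∣) ,
  isClusterGraph-mono G (λ _ → proj₂) T-cvd
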